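{- If $W_n$ is a wheel graph with $n\geq 5$, then $W_n\in\mathcal{A}(3)$, i.e., every subgraph $H$ of $W_n$ with $\Delta(H)\leq 3$ has a proper $3$-edge-coloring.
   Context: The wheel graph $W_n$ has vertex set $\{v_0,v_1,\dots,v_n\}$ and edge set $\{v_1v_2,v_2v_3,\dots,v_{n-1}v_n,v_nv_1\}\cup\{v_0v_1,\dots,v_0v_n\}$. For an integer $q\geq 2$, $\mathcal{A}(q)$ is the set of graphs $G$ such that every subgraph $H$ of $G$ with maximum degree $\Delta(H)\leq q$ has a proper $q$-edge-coloring (adjacent edges receive distinct colors). -}

module Defs where

open import Data.Nat using (ℕ; zero; suc; _≤_)
open import Data.Nat.DivMod using (_mod_)
open import Data.Fin using (Fin; zero; suc; toℕ; _≟_)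
open import Data.Bool using (Bool; true; false; _∧_; _∨_)
open import Data.List using (List; _++_; map; length; filterᵇ; allFin)
open import Data.Product using (_×_; _,_; proj₁; proj₂)
open import Relation.Nullary using (¬_)
open import Relation.Nullary.Decidable using (⌊_⌋)
open import Relation.Binary.PropositionalEquality using (_≡_)

-- Wheel graph W_n.
-- Vertices: Fin (suc n); zero is the hub v₀, suc i is the rim vertex v_{i+1}.
WVertex : ℕ → Set
WVertex n = Fin (suc n)

hub : ∀ {n} → WVertex n
hub = zero

rimV : ∀ {n} → Fin n → WVertex n
rimV i = suc i

next : ∀ {n} → Fin n → Fin n
next {suc m} i = suc (toℕ i) mod suc m

data WEdge (n : ℕ) : Set where
  spoke : Fin n → WEdge n
  rim   : Fin n → WEdge n

ends : ∀ {n} → WEdge n → WVertex n × WVertex n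
ends (spoke i) = hub , rimV i
ends (rim i)   = rimV i , rimV (next i)

allEdges : (n : ℕ) → List (WEdge n)
allEdges n = map spoke (allFin n) ++ map rim (allFin n)

incidentᵇ : ∀ {n} → WVertex n → WEdge n → Bool
incidentᵇ v e = ⌊ proj₁ (ends e) ≟ v ⌋ ∨ ⌊ proj₂ (ends e) ≟ v ⌋

Incident : ∀ {n} → WVertex n → WEdge n → Set
Incident v e = (proj₁ (ends e) ≡ v) Data.Sum.⊎ (proj₂ (ends e) ≡ v)
  where import Data.Sum

-- A subgraph H of W_n, given by its edge set (a decidable subset of E(W_n)).
-- (Vertices of H are irrelevant to edge-colourings and to Δ(H).)
Subgraph : ℕ → Set
Subgraph n = WEdge n → Bool

degree : ∀ {n} → Subgraph n → WVertex n → ℕ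
degree {n} H v = length (filterᵇ (λ e → H e ∧ incidentᵇ v e) (allEdges n))

MaxDegreeAtMost : ∀ {n} → ℕ → Subgraph n → Set
MaxDegreeAtMost {n} q H = (v : WVertex n) → degree H v ≤ q

ProperEdgeColouring : ∀ {n} (q : ℕ) → Subgraph n → (WEdge n → Fin q) → Set
ProperEdgeColouring {n} q H c =
  (e f : WEdge n) → H e ≡ true → H f ≡ true → ¬ (e ≡ f) →
  (v : WVertex n) → Incident v e → Incident v f → ¬ (c e ≡ c f)

HasProperEdgeColouring : ∀ {n} (q : ℕ) → Subgraph n → Set
HasProperEdgeColouring {n} q H = Data.Product.Σ (WEdge n → Fin q) (ProperEdgeColouring q H)
  where import Data.Product

InA : ℕ → ℕ → Set
InA q n = (H : Subgraph n) → MaxDegreeAtMost q H → HasProperEdgeColouring q H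

-- Since Δ(H) ≤ 3, at most three spokes of H meet at the hub; give them the colours 0, 1, 2
-- in the order in which they occur around the rim. It remains to 3-colour the rim cycle so
-- that consecutive rim edges differ and no rim edge repeats the colour of a spoke at one of
-- its ends. If two consecutive rim vertices carry no spoke, they can be cut out: in a
-- colouring of the shorter wheel, re-insert them with the detour of colours a′, a after an
-- edge of colour a. With at most three spokes, every rim of length at least nine has such a
-- pair, so only rims of length 5 to 8 remain, and those are settled by exhaustive search.
module Submission where

open import Defs
open import Level using (Level; _⊔_; 0ℓ)
open import Data.Nat using (ℕ; zero; suc; _+_; _≤_; _<_; _%_; s≤s; z≤n; _≤?_)
open import Data.Nat.Properties
  using (≤-refl; ≤-trans; ≤-reflexive; +-suc; +-monoʳ-≤; +-mono-≤; n≤1+n; m≤m+n; n<1+n;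
         m<n⇒m<1+n; ≰⇒>; <⇒≱; ≤-pred; module ≤-Reasoning)
open import Data.Nat.DivMod using (m<n⇒m%n≡m; n%n≡0)
open import Data.Nat.Induction using (<-rec)
open import Data.Fin using (Fin; zero; suc; toℕ; fromℕ; inject₁; _≟_)
open import Data.Fin.Properties using (toℕ-injective; suc-injective; toℕ-fromℕ<; toℕ-fromℕ; toℕ-inject₁; toℕ<n)
open import Data.Fin.Subset using (Side; Subset; inside; outside; ∣_∣)
open import Data.Fin.Subset.Properties using (∣p∣≤∣x∷p∣)
open import Data.Bool using (Bool; true; false; _∧_; T; T?)
open import Data.Bool.Properties using (∧-identityʳ)
open import Data.Bool.ListAction using (all)
open import Data.Maybe using (Maybe; just; nothing; fromMaybe)
open import Data.Maybe.Properties using (≡-dec)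
open import Data.List as List using (List; []; _∷_; take; length; filterᵇ; cartesianProductWith)
open import Data.List.Properties using (++-assoc; length-++; filter-++; map-tabulate)
open import Data.List.Membership.Propositional using (_∈_)
open import Data.List.Membership.Propositional.Properties using (∈-cartesianProductWith⁺)
import Data.List.Relation.Unary.All as All
open import Data.List.Relation.Unary.All.Properties using (all⁺)
open import Data.List.Relation.Unary.Any using (Any; any?; here; there; satisfied)
open import Data.List.Relation.Unary.Linked as Linked using (Linked; _∷_; linked?)
open import Data.List.Relation.Unary.AllPairs using (_∷_)
open import Data.List.Relation.Unary.Unique.Propositional using (Unique)
open import Data.List.Relation.Unary.Unique.Propositional.Properties using (allFin⁺)
open import Data.Vec as Vec using (Vec; []; _∷_; _++_; _∷ʳ_; lookup; zip; toList; splitAt)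
open import Data.Vec.Properties using (toList-++; toList-∷ʳ; zipWith-++; lookup-zip; lookup∘tabulate; tabulate-cong)
open import Data.Product using (Σ-syntax; ∃-syntax; _×_; _,_; proj₁; proj₂)
open import Data.Sum using (_⊎_; inj₁; inj₂; [_,_]′)
open import Function using (_∘_)
open import Relation.Binary using (Rel)
open import Relation.Binary.PropositionalEquality
open import Relation.Nullary using (Dec; yes; no; ¬?; _×-dec_; _→-dec_; contradiction)
open import Relation.Nullary.Decidable using (isYes; toWitness)

private
  variable
    a ℓ : Level
    A : Set a
    R : Rel A ℓ
    k l m n : ℕ

data LastOrInject₁ : Fin (suc m) → Set where
  last   : LastOrInject₁ (fromℕ m)
  inject : (j : Fin m) → LastOrInject₁ (inject₁ j)

lastOrInject₁ : (i : Fin (suc m)) → LastOrInject₁ i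
lastOrInject₁ {zero}  zero    = last
lastOrInject₁ {suc m} zero    = inject zero
lastOrInject₁ {suc m} (suc i) with lastOrInject₁ i
... | last     = last
... | inject j = inject (suc j)

toℕ-next : (i : Fin (suc m)) → toℕ (next i) ≡ suc (toℕ i) % suc m
toℕ-next i = toℕ-fromℕ< _

next-inject₁ : (j : Fin m) → next (inject₁ j) ≡ suc j
next-inject₁ {m} j = toℕ-injective (begin
  toℕ (next (inject₁ j))        ≡⟨ toℕ-next (inject₁ j) ⟩
  suc (toℕ (inject₁ j)) % suc m ≡⟨ cong (λ t → suc t % suc m) (toℕ-inject₁ j) ⟩
  suc (toℕ j) % suc m           ≡⟨ m<n⇒m%n≡m (s≤s (toℕ<n j)) ⟩
  suc (toℕ j)                   ∎)
  where open ≡-Reasoning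

next-fromℕ : next (fromℕ m) ≡ zero
next-fromℕ {m} = toℕ-injective (begin
  toℕ (next (fromℕ m))        ≡⟨ toℕ-next (fromℕ m) ⟩
  suc (toℕ (fromℕ m)) % suc m ≡⟨ cong (λ t → suc t % suc m) (toℕ-fromℕ m) ⟩
  suc m % suc m               ≡⟨ n%n≡0 (suc m) ⟩
  0                           ∎)
  where open ≡-Reasoning

next-injective : {i j : Fin (suc m)} → next i ≡ next j → i ≡ j
next-injective {i = i} {j} e with lastOrInject₁ i | lastOrInject₁ j
... | last      | last      = refl
... | last      | inject j′ = contradiction (trans (sym next-fromℕ) (trans e (next-inject₁ j′))) λ ()
... | inject i′ | last      = contradiction (trans (sym next-fromℕ) (trans (sym e) (next-inject₁ i′))) λ ()
... | inject i′ | inject j′ =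
  cong inject₁ (suc-injective (trans (sym (next-inject₁ i′)) (trans e (next-inject₁ j′))))

CyclicallyLinked : {A : Set a} → Rel A ℓ → List A → Set (a ⊔ ℓ)
CyclicallyLinked R xs = Linked R (xs List.++ take 1 xs)

cyclicallyLinked? : (∀ x y → Dec (R x y)) → (xs : List A) → Dec (CyclicallyLinked R xs)
cyclicallyLinked? R? xs = linked? R? (xs List.++ take 1 xs)

lookup-∷ʳ-inject₁ : (v : Vec A n) (x : A) (i : Fin n) → lookup (v ∷ʳ x) (inject₁ i) ≡ lookup v i
lookup-∷ʳ-inject₁ (y ∷ v) x zero    = refl
lookup-∷ʳ-inject₁ (y ∷ v) x (suc i) = lookup-∷ʳ-inject₁ v x i

lookup-∷ʳ-fromℕ : (v : Vec A n) (x : A) → lookup (v ∷ʳ x) (fromℕ n) ≡ x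
lookup-∷ʳ-fromℕ []      x = refl
lookup-∷ʳ-fromℕ (y ∷ v) x = lookup-∷ʳ-fromℕ v x

linked-∷ʳ : (v : Vec A n) {x : A} → Linked R (toList (v ∷ʳ x)) →
            (i : Fin n) → R (lookup v i) (lookup (v ∷ʳ x) (suc i))
linked-∷ʳ (y ∷ [])    (r ∷ _) zero    = r
linked-∷ʳ (y ∷ z ∷ v) (r ∷ _) zero    = r
linked-∷ʳ (y ∷ v)     l       (suc i) = linked-∷ʳ v (Linked.tail l) i

cyclicallyLinked-next : (v : Vec A (suc m)) → CyclicallyLinked R (toList v) →
                        (i : Fin (suc m)) → R (lookup v i) (lookup v (next i))
cyclicallyLinked-next {m = m} {R = R} v@(x ∷ _) cyc i =
  subst (R (lookup v i)) (after i) (linked-∷ʳ v (subst (Linked R) (sym (toList-∷ʳ x v)) cyc) i)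
  where
  after : (i : Fin (suc m)) → lookup (v ∷ʳ x) (suc i) ≡ lookup v (next i)
  after i with lastOrInject₁ i
  ... | last     = trans (lookup-∷ʳ-fromℕ v x) (cong (lookup v) (sym next-fromℕ))
  ... | inject j = trans (lookup-∷ʳ-inject₁ v x (suc j)) (cong (lookup v) (sym (next-inject₁ j)))

-- Once the palette is exhausted, further marked positions get no label; labels-inside
-- rules this out when the palette is long enough.
label : List A → Side → Maybe A
label _       outside = nothing
label []      inside  = nothing
label (c ∷ _) inside  = just c

leftover : List A → Side → List A
leftover p       outside = p
leftover []      inside  = []
leftover (_ ∷ p) inside  = p

labels : List A → Subset n → Vec (Maybe A) n
labels p []      = []
labels p (b ∷ S) = label p b ∷ labels (leftover p b) S

leftoverAfter : List A → Subset n → List A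
leftoverAfter p []      = p
leftoverAfter p (b ∷ S) = leftoverAfter (leftover p b) S

labels-++ : (p : List A) (S : Subset k) (T : Subset l) →
            labels p (S ++ T) ≡ labels p S ++ labels (leftoverAfter p S) T
labels-++ p []      T = refl
labels-++ p (b ∷ S) T = cong (label p b ∷_) (labels-++ (leftover p b) S T)

labels-∈ : (p : List A) (S : Subset n) (i : Fin n) {c : A} → lookup (labels p S) i ≡ just c → c ∈ p
labels-∈ (d ∷ p) (inside  ∷ S) zero    refl = here refl
labels-∈ (d ∷ p) (inside  ∷ S) (suc i) e    = there (labels-∈ p S i e)
labels-∈ []      (inside  ∷ S) (suc i) e    = labels-∈ [] S i e
labels-∈ p       (outside ∷ S) (suc i) e    = labels-∈ p S i e

labels-injective : {p : List A} (S : Subset n) → Unique p → {i j : Fin n} {c : A} →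
                   lookup (labels p S) i ≡ just c → lookup (labels p S) j ≡ just c → i ≡ j
labels-injective {p = d ∷ p} (inside ∷ S) (d∉p ∷ u) {zero}  {zero}  refl _  = refl
labels-injective {p = d ∷ p} (inside ∷ S) (d∉p ∷ u) {zero}  {suc j} refl e  =
  contradiction refl (All.lookup d∉p (labels-∈ p S j e))
labels-injective {p = d ∷ p} (inside ∷ S) (d∉p ∷ u) {suc i} {zero}  e refl =
  contradiction refl (All.lookup d∉p (labels-∈ p S i e))
labels-injective {p = d ∷ p} (inside ∷ S) (d∉p ∷ u) {suc i} {suc j} e e′   =
  cong suc (labels-injective S u e e′)
labels-injective {p = []}    (inside ∷ S)  u {suc i} {suc j} e e′ = cong suc (labels-injective S u e e′)
labels-injective             (outside ∷ S) u {suc i} {suc j} e e′ = cong suc (labels-injective S u e e′)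

labels-inside : (p : List A) (S : Subset n) (i : Fin n) → lookup S i ≡ inside → ∣ S ∣ ≤ length p →
                ∃[ c ] lookup (labels p S) i ≡ just c
labels-inside (d ∷ p) (inside  ∷ S) zero    _ _       = d , refl
labels-inside (d ∷ p) (inside  ∷ S) (suc i) e (s≤s h) = labels-inside p S i e h
labels-inside p       (outside ∷ S) (suc i) e h       = labels-inside p S i e h

Colour : Set
Colour = Fin 3

palette : List Colour
palette = List.allFin 3

-- Entry i of a rim word: the colour of the spoke at rimV i (if it is in H) and the colour
-- of the rim edge rim i, which leaves rimV i.
Entry : Set
Entry = Maybe Colour × Colour

Step : Rel Entry 0ℓ
Step (s , c) (s′ , c′) = c ≢ c′ × s ≢ just c × s′ ≢ just c

step? : (x y : Entry) → Dec (Step x y)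
step? (s , c) (s′ , c′) = ¬? (c ≟ c′) ×-dec ¬? (≡-dec _≟_ s (just c)) ×-dec ¬? (≡-dec _≟_ s′ (just c))

word : List Colour → Subset n → Vec Colour n → List Entry
word p S cs = toList (zip (labels p S) cs)

word-++ : (p : List Colour) (S : Subset k) (T : Subset l) (cs : Vec Colour k) (ct : Vec Colour l) →
          word p (S ++ T) (cs ++ ct) ≡ word p S cs List.++ word (leftoverAfter p S) T ct
word-++ p S T cs ct = begin
  toList (zip (labels p (S ++ T)) (cs ++ ct))
    ≡⟨ cong (λ L → toList (zip L (cs ++ ct))) (labels-++ p S T) ⟩
  toList (zip (labels p S ++ labels (leftoverAfter p S) T) (cs ++ ct))
    ≡⟨ cong toList (zipWith-++ _,_ (labels p S) _ cs ct) ⟩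
  toList (zip (labels p S) cs ++ zip (labels (leftoverAfter p S) T) ct)
    ≡⟨ toList-++ (zip (labels p S) cs) _ ⟩
  word p S cs List.++ word (leftoverAfter p S) T ct
    ∎
  where open ≡-Reasoning

RimColouring : Subset n → Set
RimColouring {n} S = Σ[ cs ∈ Vec Colour n ] CyclicallyLinked Step (word palette S cs)

-- Inserting two spokeless rim vertices

other : Colour → Colour
other zero    = suc zero
other (suc _) = zero

other-≢ : (c : Colour) → other c ≢ c
other-≢ zero    ()
other-≢ (suc _) ()

idle : Colour → Entry
idle c = nothing , c

-- Replacing an edge of colour c by a path coloured c, c′, c keeps the constraints at both of
-- its ends.
linked-detour : {y z : Entry} {V : List Entry} → Linked Step (y ∷ z ∷ V) →
                Linked Step (y ∷ idle (other (proj₂ y)) ∷ idle (proj₂ y) ∷ z ∷ V)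
linked-detour {_ , c} ((c≢c′ , s≢c , s′≢c) ∷ l) =
  (other-≢ c ∘ sym , s≢c , λ ()) ∷ (other-≢ c , (λ ()) , λ ()) ∷ (c≢c′ , (λ ()) , s′≢c) ∷ l

linked-insert : (Z : List Entry) {y : Entry} (W : List Entry) {h : Entry} →
                Linked Step (Z List.++ y ∷ W List.++ List.[ h ]) →
                Linked Step (Z List.++ y ∷ idle (other (proj₂ y)) ∷ idle (proj₂ y) ∷ W List.++ List.[ h ])
linked-insert []          []      l       = linked-detour l
linked-insert []          (_ ∷ _) l       = linked-detour l
linked-insert (_ ∷ [])    W       (r ∷ l) = r ∷ linked-insert [] W l
linked-insert (_ ∷ x ∷ Z) W       (r ∷ l) = r ∷ linked-insert (x ∷ Z) W l

cyclic-insert : (Z : List Entry) (y : Entry) (W : List Entry) → CyclicallyLinked Step (Z List.++ y ∷ W) →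
                CyclicallyLinked Step (Z List.++ y ∷ idle (other (proj₂ y)) ∷ idle (proj₂ y) ∷ W)
cyclic-insert []      y W l = linked-insert [] W l
cyclic-insert (x ∷ Z) y W l =
  subst (Linked Step ∘ (x ∷_)) (sym (++-assoc Z (y ∷ _) List.[ x ]))
    (linked-insert (x ∷ Z) W (subst (Linked Step ∘ (x ∷_)) (++-assoc Z (y ∷ W) List.[ x ]) l))

data HasIdlePair : Subset n → Set where
  idlePair : (A : Subset k) (b : Side) (B : Subset l) → HasIdlePair (A ++ b ∷ outside ∷ outside ∷ B)

extendColouring : (A : Subset k) (b : Side) (B : Subset l) →
                  RimColouring (A ++ b ∷ B) → RimColouring (A ++ b ∷ outside ∷ outside ∷ B)
extendColouring {k} A b B (cs , cyc) with splitAt k cs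
... | ca , c ∷ cb , refl =
  ca ++ c ∷ other c ∷ c ∷ cb ,
  subst (CyclicallyLinked Step) (sym (word-++ palette A _ ca _))
    (cyclic-insert (word palette A ca) _ _ (subst (CyclicallyLinked Step) (word-++ palette A _ ca _) cyc))

∣∣-idlePair : (A : Subset k) (b : Side) (B : Subset l) → ∣ A ++ b ∷ outside ∷ outside ∷ B ∣ ≡ ∣ A ++ b ∷ B ∣
∣∣-idlePair []            b B = refl
∣∣-idlePair (inside ∷ A)  b B = cong suc (∣∣-idlePair A b B)
∣∣-idlePair (outside ∷ A) b B = ∣∣-idlePair A b B

∷-idlePair : (x : Side) {S : Subset n} → HasIdlePair S → HasIdlePair (x ∷ S)
∷-idlePair x (idlePair A b B) = idlePair (x ∷ A) b B

idlePair-or-short : (b : Side) (S : Subset n) → HasIdlePair (b ∷ S) ⊎ n ≤ suc (∣ S ∣ + ∣ S ∣)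
idlePair-or-short b []                      = inj₂ z≤n
idlePair-or-short b (outside ∷ [])          = inj₂ ≤-refl
idlePair-or-short b (outside ∷ outside ∷ S) = inj₁ (idlePair [] b S)
idlePair-or-short b (outside ∷ inside ∷ S)  with idlePair-or-short inside S
... | inj₁ p = inj₁ (∷-idlePair b (∷-idlePair outside p))
... | inj₂ h = inj₂ (s≤s (s≤s (≤-trans h (≤-reflexive (sym (+-suc ∣ S ∣ ∣ S ∣))))))
idlePair-or-short b (inside ∷ S)            with idlePair-or-short inside S
... | inj₁ p = inj₁ (∷-idlePair b p)
... | inj₂ h = inj₂ (s≤s (≤-trans h (s≤s (+-monoʳ-≤ ∣ S ∣ (n≤1+n ∣ S ∣)))))

ShorterRimsColourable : ℕ → Set
ShorterRimsColourable n = ∀ {m} → m < n → (S : Subset m) → 5 ≤ m → ∣ S ∣ ≤ 3 → RimColouring S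

colourByShrinking : {S : Subset n} → HasIdlePair S → 7 ≤ n → ∣ S ∣ ≤ 3 → ShorterRimsColourable n → RimColouring S
colourByShrinking (idlePair {k} {l} A b B) 7≤n S≤3 rec =
  extendColouring A b B (rec shorter (A ++ b ∷ B) (≤-pred (≤-pred (subst (7 ≤_) length≡ 7≤n)))
                                                   (subst (_≤ 3) (∣∣-idlePair A b B) S≤3))
  where
  length≡ : k + suc (suc (suc l)) ≡ suc (suc (k + suc l))
  length≡ = trans (+-suc k _) (cong suc (+-suc k _))
  shorter : k + suc l < k + suc (suc (suc l))
  shorter = subst (k + suc l <_) (sym length≡) (m<n⇒m<1+n (n<1+n _))

-- Short rims, by exhaustive search

vectorsOver : List A → (n : ℕ) → List (Vec A n)
vectorsOver xs zero    = List.[ [] ]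
vectorsOver xs (suc n) = cartesianProductWith _∷_ xs (vectorsOver xs n)

∈-vectorsOver : {xs : List A} → (∀ x → x ∈ xs) → (v : Vec A n) → v ∈ vectorsOver xs n
∈-vectorsOver ∈xs []      = here refl
∈-vectorsOver ∈xs (x ∷ v) = ∈-cartesianProductWith⁺ _∷_ (∈xs x) (∈-vectorsOver ∈xs v)

∈-sides : (b : Side) → b ∈ inside ∷ outside ∷ []
∈-sides inside  = here refl
∈-sides outside = there (here refl)

-- Only candidates: whatever the search finds is checked by cyclicallyLinked?.
pathColouringsAfter : Colour → (n : ℕ) → List (Vec Colour n)
pathColouringsAfter c zero    = List.[ [] ]
pathColouringsAfter c (suc n) =
  List.concatMap (λ d → List.map (d ∷_) (pathColouringsAfter d n)) (List.filter (λ d → ¬? (c ≟ d)) palette)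

pathColourings : (n : ℕ) → List (Vec Colour n)
pathColourings zero    = List.[ [] ]
pathColourings (suc n) = List.concatMap (λ c → List.map (c ∷_) (pathColouringsAfter c n)) palette

FoundColouring : Subset n → Set
FoundColouring {n} S = ∣ S ∣ ≤ 3 → Any (CyclicallyLinked Step ∘ word palette S) (pathColourings n)

foundColouring? : (S : Subset n) → Dec (FoundColouring S)
foundColouring? S = (∣ S ∣ ≤? 3) →-dec any? (cyclicallyLinked? step? ∘ word palette S) _

byExhaustion : ∀ n → T (all (isYes ∘ foundColouring?) (vectorsOver (inside ∷ outside ∷ []) n)) →
               (S : Subset n) → ∣ S ∣ ≤ 3 → RimColouring S
byExhaustion n ok S S≤3 =
  satisfied (toWitness {a? = foundColouring? S} (All.lookup (all⁺ _ _ ok) (∈-vectorsOver ∈-sides S)) S≤3)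

-- Each _ below is the closed boolean hypothesis of byExhaustion, evaluated by the type checker.
shortRimColouring : m ≤ 3 → (S : Subset (5 + m)) → ∣ S ∣ ≤ 3 → RimColouring S
shortRimColouring z≤n                   = byExhaustion 5 _
shortRimColouring (s≤s z≤n)             = byExhaustion 6 _
shortRimColouring (s≤s (s≤s z≤n))       = byExhaustion 7 _
shortRimColouring (s≤s (s≤s (s≤s z≤n))) = byExhaustion 8 _

idlePair-in-long-rim : (b : Side) (S : Subset n) → 8 ≤ n → ∣ b ∷ S ∣ ≤ 3 → HasIdlePair (b ∷ S)
idlePair-in-long-rim b S 8≤n bS≤3 =
  [ (λ p → p) , (λ short → contradiction (≤-trans 8≤n (≤-trans short ≤7)) (<⇒≱ ≤-refl)) ]′
    (idlePair-or-short b S)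
  where
  S≤3 : ∣ S ∣ ≤ 3
  S≤3 = ≤-trans (∣p∣≤∣x∷p∣ b S) bS≤3
  ≤7 : suc (∣ S ∣ + ∣ S ∣) ≤ 7
  ≤7 = s≤s (+-mono-≤ S≤3 S≤3)

rimColouring : ∀ n (S : Subset n) → 5 ≤ n → ∣ S ∣ ≤ 3 → RimColouring S
rimColouring = <-rec _ go
  where
  go : ∀ n → ShorterRimsColourable n → (S : Subset n) → 5 ≤ n → ∣ S ∣ ≤ 3 → RimColouring S
  go _ rec (b ∷ S) (s≤s (s≤s (s≤s (s≤s (s≤s (z≤n {m})))))) S≤3 with m ≤? 3
  ... | yes m≤3 = shortRimColouring m≤3 (b ∷ S) S≤3
  ... | no  m≰3 = colourByShrinking (idlePair-in-long-rim b S (+-monoʳ-≤ 4 4≤m) S≤3)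
                                    (+-monoʳ-≤ 5 (≤-trans (s≤s (s≤s z≤n)) 4≤m)) S≤3 rec
    where
    4≤m : 4 ≤ m
    4≤m = ≰⇒> m≰3

-- From rim colourings to edge colourings of the wheel

spokeSet : Subgraph n → Subset n
spokeSet H = Vec.tabulate (λ i → H (spoke i))

∣tabulate∣≡length-filter : (f : Fin n → A) (p : A → Bool) →
                           ∣ Vec.tabulate (p ∘ f) ∣ ≡ length (filterᵇ p (List.tabulate f))
∣tabulate∣≡length-filter {n = zero}  f p = refl
∣tabulate∣≡length-filter {n = suc n} f p with p (f zero)
... | true  = cong suc (∣tabulate∣≡length-filter (f ∘ suc) p)
... | false = ∣tabulate∣≡length-filter (f ∘ suc) p

∣spokeSet∣≤degree : (H : Subgraph n) → ∣ spokeSet H ∣ ≤ degree H hub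
∣spokeSet∣≤degree {n} H = begin
  ∣ spokeSet H ∣
    ≡⟨ cong ∣_∣ (tabulate-cong (λ i → sym (∧-identityʳ (H (spoke i))))) ⟩
  ∣ Vec.tabulate (atHub ∘ spoke) ∣
    ≡⟨ ∣tabulate∣≡length-filter spoke atHub ⟩
  length (filterᵇ atHub (List.tabulate spoke))
    ≡⟨ cong (length ∘ filterᵇ atHub) (sym (map-tabulate (λ i → i) spoke)) ⟩
  length (filterᵇ atHub spokes)
    ≤⟨ m≤m+n _ _ ⟩
  length (filterᵇ atHub spokes) + length (filterᵇ atHub rims)
    ≡⟨ length-++ (filterᵇ atHub spokes) ⟨
  length (filterᵇ atHub spokes List.++ filterᵇ atHub rims)
    ≡⟨ cong length (filter-++ (T? ∘ atHub) spokes rims) ⟨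
  degree H hub
    ∎
  where
  open ≤-Reasoning
  atHub : WEdge n → Bool
  atHub e = H e ∧ incidentᵇ hub e
  spokes rims : List (WEdge n)
  spokes = List.map spoke (List.allFin n)
  rims   = List.map rim (List.allFin n)

spoke-meets-rim : {v : WVertex n} {i j : Fin n} → Incident v (spoke i) → Incident v (rim j) →
                  i ≡ j ⊎ i ≡ next j
spoke-meets-rim (inj₁ refl) (inj₁ ())
spoke-meets-rim (inj₁ refl) (inj₂ ())
spoke-meets-rim (inj₂ refl) (inj₁ e) = inj₁ (suc-injective (sym e))
spoke-meets-rim (inj₂ refl) (inj₂ e) = inj₂ (suc-injective (sym e))

rims-meet : {v : WVertex (suc m)} {i j : Fin (suc m)} → Incident v (rim i) → Incident v (rim j) →
            i ≡ j ⊎ i ≡ next j ⊎ next i ≡ j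
rims-meet (inj₁ refl) (inj₁ e) = inj₁ (suc-injective (sym e))
rims-meet (inj₁ refl) (inj₂ e) = inj₂ (inj₁ (suc-injective (sym e)))
rims-meet (inj₂ refl) (inj₁ e) = inj₂ (inj₂ (suc-injective (sym e)))
rims-meet (inj₂ refl) (inj₂ e) = inj₁ (next-injective (suc-injective (sym e)))

properColouring : (H : Subgraph (suc m)) → ∣ spokeSet H ∣ ≤ 3 → RimColouring (spokeSet H) →
                  HasProperEdgeColouring 3 H
properColouring {m} H S≤3 (cs , cyc) = colour , proper
  where
  L : Vec (Maybe Colour) (suc m)
  L = labels palette (spokeSet H)

  colour : WEdge (suc m) → Colour
  colour (spoke i) = fromMaybe zero (lookup L i)
  colour (rim i)   = lookup cs i

  step : ∀ i → Step (lookup L i , lookup cs i) (lookup L (next i) , lookup cs (next i))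
  step i = subst₂ Step (lookup-zip i L cs) (lookup-zip (next i) L cs) (cyclicallyLinked-next (zip L cs) cyc i)

  spokeLabel : ∀ {i} → H (spoke i) ≡ true → lookup L i ≡ just (colour (spoke i))
  spokeLabel {i} Hi with labels-inside palette (spokeSet H) i (trans (lookup∘tabulate (H ∘ spoke) i) Hi) S≤3
  ... | c , e rewrite e = refl

  spokes-injective : ∀ {i j} → H (spoke i) ≡ true → H (spoke j) ≡ true →
                     colour (spoke i) ≡ colour (spoke j) → i ≡ j
  spokes-injective Hi Hj e =
    labels-injective (spokeSet H) (allFin⁺ 3) (spokeLabel Hi) (trans (spokeLabel Hj) (cong just (sym e)))

  spoke≢rim : ∀ {i j} → H (spoke i) ≡ true → i ≡ j ⊎ i ≡ next j → colour (spoke i) ≢ colour (rim j)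
  spoke≢rim Hi (inj₁ refl) e = proj₁ (proj₂ (step _)) (trans (spokeLabel Hi) (cong just e))
  spoke≢rim Hi (inj₂ refl) e = proj₂ (proj₂ (step _)) (trans (spokeLabel Hi) (cong just e))

  proper : ProperEdgeColouring 3 H colour
  proper (spoke i) (spoke j) Hi Hj e≢f _ _  _  = e≢f ∘ cong spoke ∘ spokes-injective Hi Hj
  proper (spoke i) (rim j)   Hi _  _   _ vi vj = spoke≢rim Hi (spoke-meets-rim vi vj)
  proper (rim i)   (spoke j) _  Hj _   _ vi vj = spoke≢rim Hj (spoke-meets-rim vj vi) ∘ sym
  proper (rim i)   (rim j)   _  _  e≢f _ vi vj with rims-meet vi vj
  ... | inj₁ refl        = contradiction refl e≢f
  ... | inj₂ (inj₁ refl) = proj₁ (step j) ∘ sym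
  ... | inj₂ (inj₂ refl) = proj₁ (step i)

proposition2p8 : (n : ℕ) → 5 ≤ n → InA 3 n
proposition2p8 zero    ()
proposition2p8 (suc m) 5≤n H Δ≤3 = properColouring H S≤3 (rimColouring _ (spokeSet H) 5≤n S≤3)
  where
  S≤3 : ∣ spokeSet H ∣ ≤ 3
  S≤3 = ≤-trans (∣spokeSet∣≤degree H) (Δ≤3 hub)
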